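{- Let $K$ be a field, let $H$ be a subgroup of $K^\times$, and let $\varphi:K\to F$ be the canonical quotient map to the quotient hyperfield $F=K/H$. Let $A$ be an $m\times n$ matrix over $F$ with $m\ge n$. Then the following are equivalent: (1) $r_{\mathrm{mat}}(\varphi^{ -1}(A))=n$; (2) $r_{\varphi\text{ - }\mathrm{mat}}(A)=n$; (3) $r_{\mathrm{col}}(A)=n$; (4) $r_{\mathrm{mat}}(A)=n$.
   Context: A tract is a multiplicatively written commutative monoid $F$ with an absorbing element $0$ such that $F^\times=F\setminus\{0\}$ is a group, together with a null set $N_F\subseteq\mathbb{N}[F^\times]$ containing the empty sum, containing $1+\epsilon$ for a unique $\epsilon\in F^\times$, and closed under $F^\times$-scaling (formal sums are read with zero terms discarded). A field $K$ is a tract whose null set consists of formal sums summing to $0$ in $K$. The quotient hyperfield $F=K/H$ is the monoid $(K^\times/H)\cup\{0\}$ with null set consisting of the formal sums $\sum_{i=1}^k x_i$ of cosets $x_i$ for which there exist representatives $\tilde x_i\in x_i$ with $\sum_i\tilde x_i=0$ in $K$; the quotient map $\varphi:K\to F$ is a tract homomorphism, applied entrywise to matrices. $X,Y\in F^n$ are orthogonal if $\sum_iX_iY_i\in N_F$. Vectors $X_1,\dots,X_k\in F^n$ are linearly dependent if there are $c_i\in F$, not all zero, with $\sum_ic_iX_i\in(N_F)^n$ coordinatewise, and linearly independent otherwise. An $F$-matroid $M$ of rank $r$ on $[n]$ is a rank-$r$ matroid $\underline{M}$ on $[n]$ with subsets $\mathcal{C}(M),\mathcal{C}^*(M)\subseteq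 F^n$ ($F$-circuits, $F$-cocircuits), closed under $F^\times$-scaling, whose supports are circuits (resp. cocircuits) of $\underline{M}$, each circuit (resp. cocircuit) being the support of an $F$-circuit (resp. $F$-cocircuit) unique up to scaling, and every $F$-circuit orthogonal to every $F$-cocircuit. Covectors of $M$: elements of $F^n$ orthogonal to all $F$-circuits. The push-forward $\varphi_*(M')$ of a $K$-matroid $M'$ has the same underlying matroid and $F$-circuits (resp. cocircuits) $c\,\varphi(X)$ with $X$ a circuit (resp. cocircuit) of $M'$ and $c\in F^\times$. For a matrix $B$ over a tract: $r_{\mathrm{col}}(B)$ is the maximal number of linearly independent columns; $r_{\mathrm{mat}}(B)$ is the minimal rank of a matroid over that tract on the column set having all rows of $B$ as covectors (over a field this is the usual rank). $r_{\varphi\text{ - }\mathrm{mat}}(A)$ is the minimal rank of a $K$-matroid $M'$ on $[n]$ with every row of $A$ a covector of $\varphi_*(M')$; $r_{\mathrm{mat}}(\varphi^{ -1}(A))$ is the minimal rank of a matrix $A'$ over $K$ with $\varphi(A')=A$. -}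

module Defs where

open import Level using (Level; _⊔_; Lift) renaming (suc to lsuc)
open import Algebra.Bundles using (CommutativeRing)
open import Data.Nat using (ℕ; zero; suc; _≤_)
open import Data.Fin using (Fin)
import Data.Fin as Fin
open import Data.Fin.Subset using (Subset; _∈_; _∉_; _⊆_; _⊂_; ∁; _∪_; _─_; ⁅_⁆; ∣_∣)
open import Data.Product using (Σ; ∃; ∃-syntax; _×_; _,_)
open import Data.Sum using (_⊎_)
open import Relation.Nullary using (¬_)
open import Relation.Binary.PropositionalEquality using (_≡_)
open import Function.Definitions using (Injective)

record Field (c ℓ : Level) : Set (lsuc (c ⊔ ℓ)) where
  field
    commutativeRing : CommutativeRing c ℓ
  open CommutativeRing commutativeRing public
  field
    0≉1 : ¬ (0# ≈ 1#)
    inverse : ∀ x → ¬ (x ≈ 0#) → ∃[ y ] (x * y ≈ 1#)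

module _ {c ℓ} (K : Field c ℓ) where
  open Field K
  Σ[_] : ∀ {k} → (Fin k → Carrier) → Carrier
  Σ[_] {zero} x = 0#
  Σ[_] {suc k} x = x Fin.zero + Σ[_] (λ i → x (Fin.suc i))

record Subgroup× {c ℓ} (K : Field c ℓ) : Set (lsuc (c ⊔ ℓ)) where
  open Field K
  field
    H       : Carrier → Set (c ⊔ ℓ)
    H-resp  : ∀ {x y} → x ≈ y → H x → H y
    H-nz    : ∀ {x} → H x → ¬ (x ≈ 0#)
    H-one   : H 1#
    H-mul   : ∀ {x y} → H x → H y → H (x * y)
    H-inv   : ∀ {x} → H x → ∃[ y ] (H y × (x * y ≈ 1#))

-- Formal sums are indexed families Fin k → Carrier; zero terms are
-- allowed in the family and are harmless for both null sets used here.

record Tract (c ℓ : Level) : Set (lsuc (c ⊔ ℓ)) where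
  field
    Carrier : Set c
    _≈_     : Carrier → Carrier → Set ℓ
    0#      : Carrier
    _*_     : Carrier → Carrier → Carrier
    Null    : ∀ {k} → (Fin k → Carrier) → Set (c ⊔ ℓ)

fieldTract : ∀ {c ℓ} → Field c ℓ → Tract c ℓ
fieldTract {c} K = record
  { Carrier = Carrier ; _≈_ = _≈_ ; 0# = 0# ; _*_ = _*_
  ; Null = λ x → Lift c (Σ[ K ] x ≈ 0#) }
  where open Field K

-- An element of F is represented by an
-- element of K (0 represents 0, a nonzero x represents the coset xH);
-- equality in F is equality of cosets.  The quotient map φ is the
-- identity on representatives.
module Quotient {c ℓ} (K : Field c ℓ) (S : Subgroup× K) where
  open Field K
  open Subgroup× S

  _≈F_ : Carrier → Carrier → Set (c ⊔ ℓ)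
  x ≈F y = (x ≈ 0# × y ≈ 0#) ⊎ (∃[ h ] (H h × (x ≈ h * y)))

  NullF : ∀ {k} → (Fin k → Carrier) → Set (c ⊔ ℓ)
  NullF {k} x = Σ (Fin k → Carrier) λ h → ((∀ i → H (h i)) × (Σ[ K ] (λ i → h i * x i) ≈ 0#))

  quotientTract : Tract c (c ⊔ ℓ)
  quotientTract = record
    { Carrier = Carrier ; _≈_ = _≈F_ ; 0# = 0# ; _*_ = _*_ ; Null = NullF }

record Matroid (n r : ℕ) : Set₁ where
  field
    IsBasis   : Subset n → Set
    nonempty  : ∃[ B ] IsBasis B
    rank      : ∀ {B} → IsBasis B → ∣ B ∣ ≡ r
    exchange  : ∀ {B₁ B₂} → IsBasis B₁ → IsBasis B₂ → ∀ {x} → x ∈ B₁ → x ∉ B₂ →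
                ∃[ y ] (y ∈ B₂ × y ∉ B₁ × IsBasis ((B₁ ─ ⁅ x ⁆) ∪ ⁅ y ⁆))

module _ {n : ℕ} (IsBasis : Subset n → Set) where
  IndepFor : Subset n → Set
  IndepFor S = ∃[ B ] (IsBasis B × S ⊆ B)

  CircuitFor : Subset n → Set
  CircuitFor C = ¬ IndepFor C × (∀ S → S ⊂ C → IndepFor S)

module _ {n r : ℕ} (M : Matroid n r) where
  open Matroid M
  IsCircuit : Subset n → Set
  IsCircuit = CircuitFor IsBasis
  -- cocircuits: circuits of the dual matroid (bases = complements of bases)
  IsCocircuit : Subset n → Set
  IsCocircuit = CircuitFor (λ B → IsBasis (∁ B))

module OverTract {c ℓ} (T : Tract c ℓ) where
  open Tract T

  Vector : ℕ → Set c
  Vector n = Fin n → Carrier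

  Matrix : ℕ → ℕ → Set c
  Matrix m n = Fin m → Fin n → Carrier

  _≋_ : ∀ {n} → Vector n → Vector n → Set ℓ
  X ≋ Y = ∀ i → X i ≈ Y i

  scale : ∀ {n} → Carrier → Vector n → Vector n
  scale a X = λ i → a * X i

  Orth : ∀ {n} → Vector n → Vector n → Set (c ⊔ ℓ)
  Orth X Y = Null (λ i → X i * Y i)

  SuppIs : ∀ {n} → Vector n → Subset n → Set ℓ
  SuppIs X S = ∀ i → ((i ∈ S → ¬ (X i ≈ 0#)) × (i ∉ S → X i ≈ 0#))

  SameSupp : ∀ {n} → Vector n → Vector n → Set ℓ
  SameSupp X Y = ∀ i → ((X i ≈ 0# → Y i ≈ 0#) × (Y i ≈ 0# → X i ≈ 0#))

  record TMatroid (n r : ℕ) : Set (lsuc (c ⊔ ℓ)) where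
    field
      underlying : Matroid n r
      𝒞 𝒞* : Vector n → Set (c ⊔ ℓ)
      𝒞-resp  : ∀ {X Y} → X ≋ Y → 𝒞 X → 𝒞 Y
      𝒞*-resp : ∀ {X Y} → X ≋ Y → 𝒞* X → 𝒞* Y
      𝒞-scale  : ∀ {a X} → ¬ (a ≈ 0#) → 𝒞 X → 𝒞 (scale a X)
      𝒞*-scale : ∀ {a X} → ¬ (a ≈ 0#) → 𝒞* X → 𝒞* (scale a X)
      𝒞-supp  : ∀ {X} → 𝒞 X → ∃[ S ] (SuppIs X S × IsCircuit underlying S)
      𝒞*-supp : ∀ {X} → 𝒞* X → ∃[ S ] (SuppIs X S × IsCocircuit underlying S)
      𝒞-exists  : ∀ {S} → IsCircuit underlying S → ∃[ X ] (𝒞 X × SuppIs X S)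
      𝒞*-exists : ∀ {S} → IsCocircuit underlying S → ∃[ X ] (𝒞* X × SuppIs X S)
      𝒞-unique  : ∀ {X Y} → 𝒞 X → 𝒞 Y → SameSupp X Y →
                  ∃[ a ] (¬ (a ≈ 0#) × Y ≋ scale a X)
      𝒞*-unique : ∀ {X Y} → 𝒞* X → 𝒞* Y → SameSupp X Y →
                  ∃[ a ] (¬ (a ≈ 0#) × Y ≋ scale a X)
      orthogonal : ∀ {X Y} → 𝒞 X → 𝒞* Y → Orth X Y

  open TMatroid public

  Covector : ∀ {n r} → TMatroid n r → Vector n → Set (c ⊔ ℓ)
  Covector M Y = ∀ X → 𝒞 M X → Orth X Y

  LinDep : ∀ {k m} → (Fin k → Vector m) → Set (c ⊔ ℓ)
  LinDep {k} Xs = Σ (Fin k → Carrier) λ a → ((∃[ j ] ¬ (a j ≈ 0#)) × (∀ i → Null (λ j → a j * Xs j i)))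

  LinIndep : ∀ {k m} → (Fin k → Vector m) → Set (c ⊔ ℓ)
  LinIndep Xs = ¬ LinDep Xs

  column : ∀ {m n} → Matrix m n → Fin n → Vector m
  column A j = λ i → A i j

  HasIndepCols : ∀ {m n} → Matrix m n → ℕ → Set (c ⊔ ℓ)
  HasIndepCols {n = n} A k =
    ∃[ f ] (Injective _≡_ _≡_ f × LinIndep {k} (λ j → column A (f j)))

  ColRank : ∀ {m n} → Matrix m n → ℕ → Set (c ⊔ ℓ)
  ColRank A r = HasIndepCols A r × (∀ k → HasIndepCols A k → k ≤ r)

  HasMatroid : ∀ {m n} → Matrix m n → ℕ → Set (lsuc (c ⊔ ℓ))
  HasMatroid {n = n} A s = Σ (TMatroid n s) (λ M → ∀ i → Covector M (A i))

  MatRank : ∀ {m n} → Matrix m n → ℕ → Set (lsuc (c ⊔ ℓ))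
  MatRank A r = HasMatroid A r × (∀ s → HasMatroid A s → r ≤ s)

module Phi {c ℓ} (K : Field c ℓ) (S : Subgroup× K) where
  open Field K
  open Quotient K S
  module KT = OverTract (fieldTract K)
  module FT = OverTract quotientTract

  Lifts : ∀ {m n} → KT.Matrix m n → FT.Matrix m n → Set (c ⊔ ℓ)
  Lifts A' A = ∀ i j → A' i j ≈F A i j

  HasLiftOfRank : ∀ {m n} → FT.Matrix m n → ℕ → Set (c ⊔ ℓ)
  HasLiftOfRank A s = ∃[ A' ] (Lifts A' A × KT.ColRank A' s)

  LiftRank : ∀ {m n} → FT.Matrix m n → ℕ → Set (c ⊔ ℓ)
  LiftRank A r = HasLiftOfRank A r × (∀ s → HasLiftOfRank A s → r ≤ s)

  -- covectors of the push-forward φ_*(M'): orthogonal (in F) to every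
  -- F-circuit c·φ(X), X a circuit of M', c ∈ F^×
  PushCovector : ∀ {n r} → KT.TMatroid n r → FT.Vector n → Set (c ⊔ ℓ)
  PushCovector M' Y =
    ∀ X → KT.𝒞 M' X → ∀ a → ¬ (a ≈F 0#) → FT.Orth (FT.scale a X) Y

  HasPhiMatroid : ∀ {m n} → FT.Matrix m n → ℕ → Set (lsuc (c ⊔ ℓ))
  HasPhiMatroid {n = n} A s =
    Σ (KT.TMatroid n s) (λ M' → ∀ i → PushCovector M' (A i))

  PhiMatRank : ∀ {m n} → FT.Matrix m n → ℕ → Set (lsuc (c ⊔ ℓ))
  PhiMatRank A r = HasPhiMatroid A r × (∀ s → HasPhiMatroid A s → r ≤ s)

module Submission where

-- All four conditions are equivalent to the linear independence of the n columns of A over F = K/H.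
-- For r_col this is the definition, up to reindexing the columns. For r_mat(φ⁻¹(A)): the H-weights
-- witnessing that a sum is null in F can be absorbed into the entries, so column dependencies of A
-- over F are exactly column dependencies over K of lifts of A. For r_mat and r_φ-mat: if the columns
-- are independent, the free matroid (which has no circuits) has rank n and every row as a covector,
-- whereas a matroid of rank < n has a circuit, and the corresponding circuit vector (for r_φ-mat,
-- its image in F) is orthogonal to all rows, i.e. is a column dependency. Conversely, a dependency
-- a with support C is, up to scaling, the only circuit vector of the rank n - 1 matroid with bases
-- [n] - {x}, x ∈ C; its cocircuits are the singletons outside C and the pairs inside C, so every
-- vector orthogonal to a, in particular every row, is a covector. Existence of circuits and of
-- maxima is only established under double negation, which suffices because each condition is
-- equivalent to a negated statement.

open import Defs
open import Data.Nat using (ℕ; _≤_)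
open import Data.Product using (_×_)
open import Function.Bundles using (_⇔_)

open import Level using (_⊔_; Lift; lift; lower)
open import Data.Nat using (zero; suc; _<_; _∸_; s≤s)
import Data.Nat.Properties as ℕP
open import Data.Fin using (Fin; _≟_)
import Data.Fin as Fin
import Data.Fin.Properties as FinP
open import Data.Fin.Subset
  using (Subset; _∈_; _∉_; _⊆_; _⊂_; ∁; _∪_; _─_; ⁅_⁆; ∣_∣; ⊤; ⊥; inside; outside)
open import Data.Fin.Subset.Properties
  using ( _∈?_; ∈⊤; ∉⊥; ∣⊤∣≡n; ∣p∣≤n; ∣⁅x⁆∣≡1; ∣∁p∣≡n∸∣p∣; nonempty?
        ; p⊆q⇒∣p∣≤∣q∣; p⊂q⇒∣p∣<∣q∣; ⊆-antisym
        ; x∈⁅x⁆; x∈⁅y⁆⇒x≡y; x≢y⇒x∉⁅y⁆; x∉⁅y⁆⇒x≢y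
        ; x∈p⇒x∉∁p; x∈∁p⇒x∉p; x∉∁p⇒x∈p; x∉p⇒x∈∁p
        ; x∈p∪q⁺; x∈p∪q⁻; x∈p∧x∉q⇒x∈p─q )
open import Data.Vec.Base using (_∷_; []; here; there)
open import Data.Product using (∃; _,_; proj₁; proj₂)
open import Data.Sum using (_⊎_; inj₁; inj₂; [_,_]′)
open import Data.Empty using (⊥-elim) renaming (⊥ to Empty)
open import Relation.Nullary using (¬_; Dec; yes; no; ¬?; _×-dec_; ¬¬-excluded-middle; decidable-stable)
open import Relation.Binary.PropositionalEquality as ≡ using (_≡_; _≢_)
open import Function.Definitions using (Injective)
open import Data.Fin.Permutation as Perm using (Permutation)
open import Function.Bundles using (mk⇔; Equivalence)
open import Function.Construct.Symmetry using (⇔-sym)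
open import Function.Construct.Composition using (_⇔-∘_)
open import Function.Base using (_∘′_)

injective⇒surjective : ∀ {k} {f : Fin k → Fin k} → Injective _≡_ _≡_ f → ∀ y → ∃ λ j → f j ≡ y
injective⇒surjective {suc k} {f} inj y with FinP.any? (λ j → f j ≟ y)
... | yes hit = hit
... | no miss = ⊥-elim (ℕP.1+n≰n (FinP.injective⇒≤ punchOut-injective))
  where
  y≢f : ∀ j → y ≢ f j
  y≢f j eq = miss (j , ≡.sym eq)
  punchOut-injective : Injective _≡_ _≡_ (λ j → Fin.punchOut (y≢f j))
  punchOut-injective {a} {b} eq = inj (FinP.punchOut-injective (y≢f a) (y≢f b) eq)

injective⇒permutation : ∀ {k} {f : Fin k → Fin k} → Injective _≡_ _≡_ f → Permutation k k
injective⇒permutation {f = f} inj =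
  Perm.permutation f (λ y → proj₁ (surjective y)) (λ y → proj₂ (surjective y))
    (λ x → inj (proj₂ (surjective (f x))))
  where
  surjective : ∀ y → ∃ λ j → f j ≡ y
  surjective = injective⇒surjective inj

Fin⇒n∸1<n : ∀ {n} → Fin n → n ∸ 1 < n
Fin⇒n∸1<n {suc n} _ = ℕP.n<1+n n

¬¬_ : ∀ {a} → Set a → Set a
¬¬ P = ¬ ¬ P

¬¬-pure : ∀ {a} {P : Set a} → P → ¬¬ P
¬¬-pure p k = k p

¬¬-bind : ∀ {a b} {P : Set a} {Q : Set b} → ¬¬ P → (P → ¬¬ Q) → ¬¬ Q
¬¬-bind p f k = p (λ x → f x k)

¬¬-∀-Fin : ∀ {a k} {P : Fin k → Set a} → (∀ j → ¬¬ P j) → ¬¬ (∀ j → P j)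
¬¬-∀-Fin {k = zero} f = ¬¬-pure (λ ())
¬¬-∀-Fin {k = suc k} {P} f =
  ¬¬-bind (f Fin.zero) λ p₀ →
  ¬¬-bind (¬¬-∀-Fin {P = λ j → P (Fin.suc j)} (λ j → f (Fin.suc j))) λ pₛ →
  ¬¬-pure λ { Fin.zero → p₀ ; (Fin.suc j) → pₛ j }

¬¬-∀-Subset : ∀ {a n} {P : Subset n → Set a} → (∀ S → ¬¬ P S) → ¬¬ (∀ S → P S)
¬¬-∀-Subset {n = zero} f = ¬¬-bind (f []) λ p → ¬¬-pure λ { [] → p }
¬¬-∀-Subset {n = suc n} {P} f =
  ¬¬-bind (¬¬-∀-Subset {P = λ S → P (inside ∷ S)} (λ S → f (inside ∷ S))) λ pᵢ →
  ¬¬-bind (¬¬-∀-Subset {P = λ S → P (outside ∷ S)} (λ S → f (outside ∷ S))) λ pₒ →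
  ¬¬-pure λ { (inside ∷ S) → pᵢ S ; (outside ∷ S) → pₒ S }

¬¬-∃-greatest : ∀ {a} (P : ℕ → Set a) (n : ℕ) → P 0 → (∀ k → P k → k ≤ n) →
                ¬¬ (∃ λ r → P r × (∀ k → P k → k ≤ r))
¬¬-∃-greatest P n p₀ bounded =
  ¬¬-bind (greatestBelow n) λ (r , pr , max) → ¬¬-pure (r , pr , λ k pk → max k pk (bounded k pk))
  where
  greatestBelow : ∀ b → ¬¬ (∃ λ r → P r × (∀ k → P k → k ≤ b → k ≤ r))
  greatestBelow zero = ¬¬-pure (0 , p₀ , λ _ _ k≤0 → k≤0)
  greatestBelow (suc b) =
    ¬¬-bind (greatestBelow b) λ (r , pr , max) →
    ¬¬-bind ¬¬-excluded-middle λ where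
      (yes pb) → ¬¬-pure (suc b , pb , λ _ _ k≤1+b → k≤1+b)
      (no ¬pb) → ¬¬-pure (r , pr , λ k pk k≤1+b →
                   max k pk (ℕP.≤-pred (ℕP.≤∧≢⇒< k≤1+b λ { ≡.refl → ¬pb pk })))

satisfying : ∀ {a n} {P : Fin n → Set a} → (∀ j → Dec (P j)) → Subset n
satisfying {n = zero} P? = []
satisfying {n = suc n} P? with P? Fin.zero
... | yes _ = inside ∷ satisfying (λ j → P? (Fin.suc j))
... | no _ = outside ∷ satisfying (λ j → P? (Fin.suc j))

∈-satisfying⁻ : ∀ {a n} {P : Fin n → Set a} (P? : ∀ j → Dec (P j)) {i} → i ∈ satisfying P? → P i
∈-satisfying⁻ {n = suc n} P? i∈ with P? Fin.zero
∈-satisfying⁻ P? here | yes p = p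
∈-satisfying⁻ P? (there i∈) | yes _ = ∈-satisfying⁻ (λ j → P? (Fin.suc j)) i∈
∈-satisfying⁻ P? (there i∈) | no _ = ∈-satisfying⁻ (λ j → P? (Fin.suc j)) i∈

∉-satisfying⁻ : ∀ {a n} {P : Fin n → Set a} (P? : ∀ j → Dec (P j)) {i} → i ∉ satisfying P? → ¬ P i
∉-satisfying⁻ {n = suc n} P? {i} i∉ with P? Fin.zero
∉-satisfying⁻ P? {Fin.zero} i∉ | yes _ = ⊥-elim (i∉ here)
∉-satisfying⁻ P? {Fin.zero} i∉ | no ¬p = ¬p
∉-satisfying⁻ P? {Fin.suc i} i∉ | yes _ = ∉-satisfying⁻ (λ j → P? (Fin.suc j)) (λ i∈ → i∉ (there i∈))
∉-satisfying⁻ P? {Fin.suc i} i∉ | no _ = ∉-satisfying⁻ (λ j → P? (Fin.suc j)) (λ i∈ → i∉ (there i∈))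

x∈p─q⇒x∉q : ∀ {n} {x : Fin n} (p q : Subset n) → x ∈ p ─ q → x ∉ q
x∈p─q⇒x∉q (inside ∷ p) (outside ∷ q) here ()
x∈p─q⇒x∉q (_ ∷ p) (_ ∷ q) (there x∈) (there x∈q) = x∈p─q⇒x∉q p q x∈ x∈q

x∈∁⁅y⁆⇒x≢y : ∀ {n} {x y : Fin n} → x ∈ ∁ ⁅ y ⁆ → x ≢ y
x∈∁⁅y⁆⇒x≢y {y = y} x∈ ≡.refl = x∈∁p⇒x∉p x∈ (x∈⁅x⁆ y)

x≢y⇒x∈∁⁅y⁆ : ∀ {n} {x y : Fin n} → x ≢ y → x ∈ ∁ ⁅ y ⁆
x≢y⇒x∈∁⁅y⁆ x≢y = x∉p⇒x∈∁p (x≢y⇒x∉⁅y⁆ x≢y)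

x∉∁⁅y⁆⇒x≡y : ∀ {n} {x y : Fin n} → x ∉ ∁ ⁅ y ⁆ → x ≡ y
x∉∁⁅y⁆⇒x≡y {y = y} x∉ = x∈⁅y⁆⇒x≡y y (x∉∁p⇒x∈p x∉)

x∈p⇒⁅x⁆⊆p : ∀ {n} {x : Fin n} {p} → x ∈ p → ⁅ x ⁆ ⊆ p
x∈p⇒⁅x⁆⊆p {x = x} x∈p y∈⁅x⁆ = ≡.subst (_∈ _) (≡.sym (x∈⁅y⁆⇒x≡y x y∈⁅x⁆)) x∈p

circuit-nonempty : ∀ {n} {IsBasis : Subset n → Set} → ∃ IsBasis →
                   ∀ {C} → CircuitFor IsBasis C → ∃ (_∈ C)
circuit-nonempty (B , isBasis) {C} (dependent , _) with nonempty? C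
... | yes nonempty = nonempty
... | no empty = ⊥-elim (dependent (B , isBasis , λ {x} x∈C → ⊥-elim (empty (x , x∈C))))

module _ {n r : ℕ} (M : Matroid n r) where
  open Matroid M

  dependent⇒¬¬circuit : ∀ k S → ∣ S ∣ < k → ¬ IndepFor IsBasis S → ¬¬ ∃ (IsCircuit M)
  dependent⇒¬¬circuit (suc k) S ∣S∣<1+k dependent noCircuit =
    ¬¬-∀-Subset properSubsetIndep (λ minimal → noCircuit (S , dependent , minimal))
    where
    properSubsetIndep : ∀ T → ¬¬ (T ⊂ S → IndepFor IsBasis T)
    properSubsetIndep T = ¬¬-bind ¬¬-excluded-middle λ
      { (yes indep) → ¬¬-pure (λ _ → indep)
      ; (no dep) → ¬¬-pure λ T⊂S → ⊥-elim (dependent⇒¬¬circuit k T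
          (ℕP.<-≤-trans (p⊂q⇒∣p∣<∣q∣ T⊂S) (ℕP.≤-pred ∣S∣<1+k)) dep noCircuit) }

  rank<n⇒¬¬circuit : r < n → ¬¬ ∃ (IsCircuit M)
  rank<n⇒¬¬circuit r<n = dependent⇒¬¬circuit (suc n) ⊤ (s≤s (∣p∣≤n ⊤)) groundDependent
    where
    groundDependent : ¬ IndepFor IsBasis ⊤
    groundDependent (B , isBasis , ⊤⊆B) = ℕP.<⇒≱ r<n (begin
      n          ≡⟨ ∣⊤∣≡n n ⟨
      ∣ ⊤ {n} ∣  ≤⟨ p⊆q⇒∣p∣≤∣q∣ ⊤⊆B ⟩
      ∣ B ∣      ≡⟨ rank isBasis ⟩
      r          ∎)
      where open ℕP.≤-Reasoning

freeMatroid : (n : ℕ) → Matroid n n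
freeMatroid n = record
  { IsBasis = λ B → ∀ i → i ∈ B
  ; nonempty = ⊤ , λ _ → ∈⊤
  ; rank = λ {B} full → ℕP.≤-antisym (∣p∣≤n B)
      (≡.subst (_≤ ∣ B ∣) (∣⊤∣≡n n) (p⊆q⇒∣p∣≤∣q∣ {p = ⊤} λ {x} _ → full x))
  ; exchange = λ _ full₂ _ x∉B₂ → ⊥-elim (x∉B₂ (full₂ _))
  }

module _ {n : ℕ} where

  freeMatroid-noCircuit : ∀ {S} → ¬ IsCircuit (freeMatroid n) S
  freeMatroid-noCircuit (dependent , _) = dependent (⊤ , (λ _ → ∈⊤) , λ _ → ∈⊤)

  private
    ∁⊥-full : ∀ i → i ∈ ∁ (⊥ {n})
    ∁⊥-full i = x∉p⇒x∈∁p ∉⊥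

  freeMatroid-⁅⁆-cocircuit : ∀ p → IsCocircuit (freeMatroid n) ⁅ p ⁆
  freeMatroid-⁅⁆-cocircuit p = dependent , minimal
    where
    dependent : ¬ IndepFor (λ B → ∀ i → i ∈ ∁ B) ⁅ p ⁆
    dependent (_ , full , ⁅p⁆⊆B) = x∈p⇒x∉∁p (⁅p⁆⊆B (x∈⁅x⁆ p)) (full p)
    minimal : ∀ T → T ⊂ ⁅ p ⁆ → IndepFor (λ B → ∀ i → i ∈ ∁ B) T
    minimal T (T⊆⁅p⁆ , x , x∈⁅p⁆ , x∉T) = ⊥ , ∁⊥-full , λ {y} y∈T → ⊥-elim (x∉T
      (≡.subst (_∈ T) (≡.trans (x∈⁅y⁆⇒x≡y p (T⊆⁅p⁆ y∈T)) (≡.sym (x∈⁅y⁆⇒x≡y p x∈⁅p⁆))) y∈T))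

  freeMatroid-cocircuit⇒singleton : ∀ {S} → IsCocircuit (freeMatroid n) S →
                                    ∃ λ p → p ∈ S × (∀ q → q ∈ S → q ≡ p)
  freeMatroid-cocircuit⇒singleton cocircuit@(_ , minimal)
    with circuit-nonempty (⊥ , ∁⊥-full) cocircuit
  ... | p , p∈S = p , p∈S , λ q q∈S → decidable-stable (q ≟ p) λ q≢p →
          proj₁ (freeMatroid-⁅⁆-cocircuit p) (minimal ⁅ p ⁆ (x∈p⇒⁅x⁆⊆p p∈S , q , q∈S , x≢y⇒x∉⁅y⁆ q≢p))

-- The matroid U(|C| - 1, |C|) ⊕ (free matroid on the complement of C), whose only circuit is C.
module SingleCircuitMatroid {n : ℕ} (C : Subset n) {j₀ : Fin n} (j₀∈C : j₀ ∈ C) where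

  IsBasis : Subset n → Set
  IsBasis B = ∃ λ x → x ∈ C × B ≡ ∁ ⁅ x ⁆

  matroid : Matroid n (n ∸ 1)
  matroid = record
    { IsBasis = IsBasis
    ; nonempty = ∁ ⁅ j₀ ⁆ , j₀ , j₀∈C , ≡.refl
    ; rank = λ { (x , _ , ≡.refl) → ≡.trans (∣∁p∣≡n∸∣p∣ ⁅ x ⁆) (≡.cong (n ∸_) (∣⁅x⁆∣≡1 x)) }
    ; exchange = exchange
    }
    where
    exchange : ∀ {B₁ B₂} → IsBasis B₁ → IsBasis B₂ → ∀ {x} → x ∈ B₁ → x ∉ B₂ →
               ∃ λ y → y ∈ B₂ × y ∉ B₁ × IsBasis ((B₁ ─ ⁅ x ⁆) ∪ ⁅ y ⁆)
    exchange (x₁ , _ , ≡.refl) (x₂ , x₂∈C , ≡.refl) {x} x∈B₁ x∉B₂ =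
      x₁ , x≢y⇒x∈∁⁅y⁆ x₁≢x₂ , x∈p⇒x∉∁p (x∈⁅x⁆ x₁) , x₂ , x₂∈C , ⊆-antisym ⊆∁⁅x₂⁆ ∁⁅x₂⁆⊆
      where
      x≡x₂ : x ≡ x₂
      x≡x₂ = x∉∁⁅y⁆⇒x≡y x∉B₂
      x₁≢x₂ : x₁ ≢ x₂
      x₁≢x₂ x₁≡x₂ = x∈∁⁅y⁆⇒x≢y x∈B₁ (≡.trans x≡x₂ (≡.sym x₁≡x₂))
      ⊆∁⁅x₂⁆ : (∁ ⁅ x₁ ⁆ ─ ⁅ x ⁆) ∪ ⁅ x₁ ⁆ ⊆ ∁ ⁅ x₂ ⁆
      ⊆∁⁅x₂⁆ {z} z∈ with x∈p∪q⁻ (∁ ⁅ x₁ ⁆ ─ ⁅ x ⁆) ⁅ x₁ ⁆ z∈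
      ... | inj₁ z∈─ = x≢y⇒x∈∁⁅y⁆ λ { ≡.refl →
              x∈p─q⇒x∉q (∁ ⁅ x₁ ⁆) ⁅ x ⁆ z∈─ (≡.subst (_∈ ⁅ x ⁆) x≡x₂ (x∈⁅x⁆ x)) }
      ... | inj₂ z∈⁅x₁⁆ = x≢y⇒x∈∁⁅y⁆ λ z≡x₂ → x₁≢x₂ (≡.trans (≡.sym (x∈⁅y⁆⇒x≡y x₁ z∈⁅x₁⁆)) z≡x₂)
      ∁⁅x₂⁆⊆ : ∁ ⁅ x₂ ⁆ ⊆ (∁ ⁅ x₁ ⁆ ─ ⁅ x ⁆) ∪ ⁅ x₁ ⁆
      ∁⁅x₂⁆⊆ {z} z∈ with z ≟ x₁
      ... | yes ≡.refl = x∈p∪q⁺ (inj₂ (x∈⁅x⁆ z))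
      ... | no z≢x₁ = x∈p∪q⁺ (inj₁ (x∈p∧x∉q⇒x∈p─q (x≢y⇒x∈∁⁅y⁆ z≢x₁)
                        (x≢y⇒x∉⁅y⁆ λ z≡x → x∈∁⁅y⁆⇒x≢y z∈ (≡.trans z≡x x≡x₂))))

  indep⇒missesC : ∀ {S} → IndepFor IsBasis S → ∃ λ x → x ∈ C × x ∉ S
  indep⇒missesC (_ , (x , x∈C , ≡.refl) , S⊆B) = x , x∈C , λ x∈S → x∈p⇒x∉∁p (x∈⁅x⁆ x) (S⊆B x∈S)

  missesC⇒indep : ∀ {S x} → x ∈ C → x ∉ S → IndepFor IsBasis S
  missesC⇒indep x∈C x∉S =
    _ , (_ , x∈C , ≡.refl) , λ {y} y∈S → x≢y⇒x∈∁⁅y⁆ λ { ≡.refl → x∉S y∈S }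

  C-isCircuit : IsCircuit matroid C
  C-isCircuit = (λ indep → let _ , x∈C , x∉C = indep⇒missesC indep in x∉C x∈C)
              , λ { T (_ , x , x∈C , x∉T) → missesC⇒indep x∈C x∉T }

  circuit⇒≐C : ∀ {S} → IsCircuit matroid S → ∀ i → (i ∈ S → i ∈ C) × (i ∈ C → i ∈ S)
  circuit⇒≐C {S} (dependent , minimal) i = S⊆C , C⊆S
    where
    C⊆S : ∀ {j} → j ∈ C → j ∈ S
    C⊆S {j} j∈C = decidable-stable (j ∈? S) λ j∉S → dependent (missesC⇒indep j∈C j∉S)
    S⊆C : i ∈ S → i ∈ C
    S⊆C i∈S = decidable-stable (i ∈? C) λ i∉C →
      let _ , x∈C , x∉C = indep⇒missesC (minimal C (C⊆S , i , i∈S , i∉C)) in x∉C x∈C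

  CoIndep : Subset n → Set
  CoIndep = IndepFor (λ B → IsBasis (∁ B))

  coindep⇒⊆⁅⁆ : ∀ {S} → CoIndep S → ∃ λ x → x ∈ C × (∀ y → y ∈ S → y ≡ x)
  coindep⇒⊆⁅⁆ (B , (x , x∈C , ∁B≡∁⁅x⁆) , S⊆B) = x , x∈C ,
    λ y y∈S → x∉∁⁅y⁆⇒x≡y λ y∈∁⁅x⁆ → x∈p⇒x∉∁p (S⊆B y∈S) (≡.subst (y ∈_) (≡.sym ∁B≡∁⁅x⁆) y∈∁⁅x⁆)

  ⊆⁅⁆⇒coindep : ∀ {S x} → x ∈ C → (∀ y → y ∈ S → y ≡ x) → CoIndep S
  ⊆⁅⁆⇒coindep {x = x} x∈C S⊆⁅x⁆ = ⁅ x ⁆ , (x , x∈C , ≡.refl) ,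
    λ {y} y∈S → ≡.subst (_∈ ⁅ x ⁆) (≡.sym (S⊆⁅x⁆ y y∈S)) (x∈⁅x⁆ x)

  data CocircuitShape (S : Subset n) : Set where
    singleton : ∀ p → p ∉ C → p ∈ S → (∀ r → r ∈ S → r ≡ p) → CocircuitShape S
    pair      : ∀ p q → p ∈ C → q ∈ C → p ≢ q → p ∈ S → q ∈ S →
                (∀ r → r ∈ S → r ≡ p ⊎ r ≡ q) → CocircuitShape S

  module _ {S} (cocircuit : IsCocircuit matroid S) where
    private
      dependent : ¬ CoIndep S
      dependent = proj₁ cocircuit
      minimal : ∀ T → T ⊂ S → CoIndep T
      minimal = proj₂ cocircuit

    cocircuit-outsideC : ∀ {p} → p ∈ S → p ∉ C → ∀ r → r ∈ S → r ≡ p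
    cocircuit-outsideC {p} p∈S p∉C r r∈S with r ≟ p
    ... | yes r≡p = r≡p
    ... | no r≢p with coindep⇒⊆⁅⁆ (minimal ⁅ p ⁆ (x∈p⇒⁅x⁆⊆p p∈S , r , r∈S , x≢y⇒x∉⁅y⁆ r≢p))
    ...   | x , x∈C , ⁅p⁆≡x = ⊥-elim (p∉C (≡.subst (_∈ C) (≡.sym (⁅p⁆≡x p (x∈⁅x⁆ p))) x∈C))

    cocircuit-atMostPair : ∀ {p q} → p ∈ S → q ∈ S → p ≢ q → ∀ r → r ∈ S → r ≡ p ⊎ r ≡ q
    cocircuit-atMostPair {p} {q} p∈S q∈S p≢q r r∈S with r ≟ p | r ≟ q
    ... | yes r≡p | _ = inj₁ r≡p
    ... | no _ | yes r≡q = inj₂ r≡q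
    ... | no r≢p | no r≢q with coindep⇒⊆⁅⁆ (minimal (⁅ p ⁆ ∪ ⁅ q ⁆) ⁅p,q⁆⊂S)
      where
      ⁅p,q⁆⊂S : ⁅ p ⁆ ∪ ⁅ q ⁆ ⊂ S
      ⁅p,q⁆⊂S = (λ y∈ → [ x∈p⇒⁅x⁆⊆p p∈S , x∈p⇒⁅x⁆⊆p q∈S ]′ (x∈p∪q⁻ ⁅ p ⁆ ⁅ q ⁆ y∈))
              , r , r∈S , λ r∈ → [ r≢p ∘′ x∈⁅y⁆⇒x≡y p , r≢q ∘′ x∈⁅y⁆⇒x≡y q ]′ (x∈p∪q⁻ ⁅ p ⁆ ⁅ q ⁆ r∈)
    ...   | _ , _ , ⁅p,q⁆≡x = ⊥-elim (p≢q (≡.trans (⁅p,q⁆≡x p (x∈p∪q⁺ (inj₁ (x∈⁅x⁆ p))))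
                                                   (≡.sym (⁅p,q⁆≡x q (x∈p∪q⁺ (inj₂ (x∈⁅x⁆ q)))))))

    cocircuit-notSingletonInC : ∀ {p} → p ∈ S → p ∈ C → ∃ λ q → q ∈ S × q ≢ p
    cocircuit-notSingletonInC {p} p∈S p∈C with FinP.any? (λ q → (q ∈? S) ×-dec ¬? (q ≟ p))
    ... | yes (q , q∈S , q≢p) = q , q∈S , q≢p
    ... | no none = ⊥-elim (dependent (⊆⁅⁆⇒coindep p∈C onlyP))
      where
      onlyP : ∀ y → y ∈ S → y ≡ p
      onlyP y y∈S = decidable-stable (y ≟ p) λ y≢p → none (y , y∈S , y≢p)

    cocircuit-shape : CocircuitShape S
    cocircuit-shape with circuit-nonempty (⁅ j₀ ⁆ , j₀ , j₀∈C , ≡.refl) cocircuit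
    ... | p , p∈S with p ∈? C
    ...   | no p∉C = singleton p p∉C p∈S (cocircuit-outsideC p∈S p∉C)
    ...   | yes p∈C with cocircuit-notSingletonInC p∈S p∈C
    ...     | q , q∈S , q≢p with q ∈? C
    ...       | no q∉C = ⊥-elim (q≢p (≡.sym (cocircuit-outsideC q∈S q∉C p p∈S)))
    ...       | yes q∈C = pair p q p∈C q∈C (q≢p ∘′ ≡.sym) p∈S q∈S
                              (cocircuit-atMostPair p∈S q∈S (q≢p ∘′ ≡.sym))

module FieldProperties {c ℓ} (K : Field c ℓ) where
  open Field K
  open import Algebra.Properties.Semiring.Sum semiring using (sum; sum-permute)
  open import Algebra.Properties.Ring ring using (-‿distribˡ-*; -‿distribʳ-*)
  open import Algebra.Properties.Group +-group using (⁻¹-involutive; ε⁻¹≈ε; inverseˡ-unique)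
  open import Algebra.Properties.CommutativeSemigroup *-commutativeSemigroup public
    using (interchange; x∙yz≈y∙xz; x∙yz≈yx∙z)
  open import Relation.Binary.Reasoning.Setoid setoid

  x≈0⇒y*x≈0 : ∀ y {x} → x ≈ 0# → y * x ≈ 0#
  x≈0⇒y*x≈0 y x≈0 = trans (*-congˡ x≈0) (zeroʳ y)

  x≈0⇒x*y≈0 : ∀ y {x} → x ≈ 0# → x * y ≈ 0#
  x≈0⇒x*y≈0 y x≈0 = trans (*-congʳ x≈0) (zeroˡ y)

  Σ-cong : ∀ {k} {x y : Fin k → Carrier} → (∀ j → x j ≈ y j) → Σ[ K ] x ≈ Σ[ K ] y
  Σ-cong {zero} _ = refl
  Σ-cong {suc k} x≈y = +-cong (x≈y Fin.zero) (Σ-cong (λ j → x≈y (Fin.suc j)))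

  Σ-zero : ∀ {k} {x : Fin k → Carrier} → (∀ j → x j ≈ 0#) → Σ[ K ] x ≈ 0#
  Σ-zero {zero} _ = refl
  Σ-zero {suc k} x≈0 = trans (+-cong (x≈0 Fin.zero) (Σ-zero (λ j → x≈0 (Fin.suc j)))) (+-identityˡ 0#)

  *-distribˡ-Σ : ∀ {k} a (x : Fin k → Carrier) → a * Σ[ K ] x ≈ Σ[ K ] (λ j → a * x j)
  *-distribˡ-Σ {zero} a _ = zeroʳ a
  *-distribˡ-Σ {suc k} a x = trans (distribˡ a _ _) (+-congˡ (*-distribˡ-Σ a (λ j → x (Fin.suc j))))

  Σ≡sum : ∀ {k} (x : Fin k → Carrier) → Σ[ K ] x ≡ sum x
  Σ≡sum {zero} _ = ≡.refl
  Σ≡sum {suc k} x = ≡.cong (x Fin.zero +_) (Σ≡sum (λ j → x (Fin.suc j)))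

  Σ-permute : ∀ {k} {f : Fin k → Fin k} → Injective _≡_ _≡_ f → (x : Fin k → Carrier) →
              Σ[ K ] (λ j → x (f j)) ≈ Σ[ K ] x
  Σ-permute {f = f} inj x = begin
    Σ[ K ] (λ j → x (f j))  ≡⟨ Σ≡sum (λ j → x (f j)) ⟩
    sum (λ j → x (f j))     ≈⟨ sum-permute x (injective⇒permutation inj) ⟨
    sum x                   ≡⟨ Σ≡sum x ⟨
    Σ[ K ] x                ∎

  Σ-single : ∀ {k} (x : Fin k → Carrier) p → (∀ j → j ≢ p → x j ≈ 0#) → Σ[ K ] x ≈ x p
  Σ-single x Fin.zero x≈0 =
    trans (+-congˡ (Σ-zero (λ j → x≈0 (Fin.suc j) λ ()))) (+-identityʳ _)
  Σ-single x (Fin.suc p) x≈0 =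
    trans (+-cong (x≈0 Fin.zero λ ()) (Σ-single (λ j → x (Fin.suc j)) p
      λ j j≢p → x≈0 (Fin.suc j) (j≢p ∘′ FinP.suc-injective))) (+-identityˡ _)

  Σ-pair : ∀ {k} (x : Fin k → Carrier) p q → p ≢ q → (∀ j → j ≢ p → j ≢ q → x j ≈ 0#) →
           Σ[ K ] x ≈ x p + x q
  Σ-pair x Fin.zero Fin.zero p≢q _ = ⊥-elim (p≢q ≡.refl)
  Σ-pair x Fin.zero (Fin.suc q) _ x≈0 = +-congˡ (Σ-single (λ j → x (Fin.suc j)) q
    λ j j≢q → x≈0 (Fin.suc j) (λ ()) (j≢q ∘′ FinP.suc-injective))
  Σ-pair x (Fin.suc p) Fin.zero _ x≈0 = trans (+-comm _ _) (+-congʳ (Σ-single (λ j → x (Fin.suc j)) p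
    λ j j≢p → x≈0 (Fin.suc j) (j≢p ∘′ FinP.suc-injective) (λ ())))
  Σ-pair x (Fin.suc p) (Fin.suc q) p≢q x≈0 = trans (+-cong (x≈0 Fin.zero (λ ()) (λ ()))
    (Σ-pair (λ j → x (Fin.suc j)) p q (p≢q ∘′ ≡.cong Fin.suc)
      λ j j≢p j≢q → x≈0 (Fin.suc j) (j≢p ∘′ FinP.suc-injective) (j≢q ∘′ FinP.suc-injective)))
    (+-identityˡ _)

  1≉0 : ¬ (1# ≈ 0#)
  1≉0 1≈0 = 0≉1 (sym 1≈0)

  _⁻¹⟨_⟩ : ∀ x → ¬ (x ≈ 0#) → Carrier
  x ⁻¹⟨ x≉0 ⟩ = proj₁ (inverse x x≉0)

  ⁻¹-inverseˡ : ∀ x (x≉0 : ¬ (x ≈ 0#)) → x ⁻¹⟨ x≉0 ⟩ * x ≈ 1#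
  ⁻¹-inverseˡ x x≉0 = trans (*-comm _ _) (proj₂ (inverse x x≉0))

  ⁻¹-cancelˡ : ∀ x (x≉0 : ¬ (x ≈ 0#)) y → x ⁻¹⟨ x≉0 ⟩ * (x * y) ≈ y
  ⁻¹-cancelˡ x x≉0 y = begin
    x ⁻¹⟨ x≉0 ⟩ * (x * y)  ≈⟨ *-assoc _ _ _ ⟨
    (x ⁻¹⟨ x≉0 ⟩ * x) * y  ≈⟨ *-congʳ (⁻¹-inverseˡ x x≉0) ⟩
    1# * y                 ≈⟨ *-identityˡ y ⟩
    y                      ∎

  x≈[x*y⁻¹]*y : ∀ x y (y≉0 : ¬ (y ≈ 0#)) → x ≈ (x * y ⁻¹⟨ y≉0 ⟩) * y
  x≈[x*y⁻¹]*y x y y≉0 = sym (trans (*-assoc _ _ _) (trans (*-congˡ (⁻¹-inverseˡ y y≉0)) (*-identityʳ x)))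

  *-cancelˡ : ∀ {u x y} → ¬ (u ≈ 0#) → u * x ≈ u * y → x ≈ y
  *-cancelˡ {u} {x} {y} u≉0 ux≈uy = begin
    x                      ≈⟨ ⁻¹-cancelˡ u u≉0 x ⟨
    u ⁻¹⟨ u≉0 ⟩ * (u * x)  ≈⟨ *-congˡ ux≈uy ⟩
    u ⁻¹⟨ u≉0 ⟩ * (u * y)  ≈⟨ ⁻¹-cancelˡ u u≉0 y ⟩
    y                      ∎

  *-nonzero : ∀ {x y} → ¬ (x ≈ 0#) → ¬ (y ≈ 0#) → ¬ (x * y ≈ 0#)
  *-nonzero {x} {y} x≉0 y≉0 xy≈0 = y≉0 (*-cancelˡ x≉0 (trans xy≈0 (sym (zeroʳ x))))

  ⁻¹-nonzero : ∀ x (x≉0 : ¬ (x ≈ 0#)) → ¬ (x ⁻¹⟨ x≉0 ⟩ ≈ 0#)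
  ⁻¹-nonzero x x≉0 x⁻¹≈0 = 1≉0 (trans (sym (⁻¹-inverseˡ x x≉0)) (x≈0⇒x*y≈0 x x⁻¹≈0))

  -‿nonzero : ∀ {x} → ¬ (x ≈ 0#) → ¬ (- x ≈ 0#)
  -‿nonzero {x} x≉0 -x≈0 = x≉0 (trans (sym (⁻¹-involutive x)) (trans (-‿cong -x≈0) ε⁻¹≈ε))

  x*y+y*-x≈0 : ∀ x y → x * y + y * (- x) ≈ 0#
  x*y+y*-x≈0 x y = trans (+-cong (*-comm x y) (sym (-‿distribʳ-* y x))) (-‿inverseʳ (y * x))

  x₁+x₂≈0∧y₁+y₂≈0⇒y₂*x₁≈y₁*x₂ : ∀ {x₁ x₂ y₁ y₂} → x₁ + x₂ ≈ 0# → y₁ + y₂ ≈ 0# →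
                                y₂ * x₁ ≈ y₁ * x₂
  x₁+x₂≈0∧y₁+y₂≈0⇒y₂*x₁≈y₁*x₂ {x₁} {x₂} {y₁} {y₂} x₁+x₂≈0 y₁+y₂≈0 = begin
    y₂ * x₁      ≈⟨ *-congˡ (inverseˡ-unique x₁ x₂ x₁+x₂≈0) ⟩
    y₂ * (- x₂)  ≈⟨ -‿distribʳ-* y₂ x₂ ⟨
    - (y₂ * x₂)  ≈⟨ -‿distribˡ-* y₂ x₂ ⟩
    (- y₂) * x₂  ≈⟨ *-congʳ (inverseˡ-unique y₁ y₂ y₁+y₂≈0) ⟨
    y₁ * x₂      ∎

  unitVector : ∀ {n} → Fin n → Fin n → Carrier
  unitVector p j with j ≟ p
  ... | yes _ = 1#
  ... | no _ = 0#

  unitVector-at : ∀ {n} (p : Fin n) → unitVector p p ≈ 1#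
  unitVector-at p with p ≟ p
  ... | yes _ = refl
  ... | no p≢p = ⊥-elim (p≢p ≡.refl)

  unitVector-off : ∀ {n} {p j : Fin n} → j ≢ p → unitVector p j ≈ 0#
  unitVector-off {p = p} {j} j≢p with j ≟ p
  ... | yes j≡p = ⊥-elim (j≢p j≡p)
  ... | no _ = refl

  pairVector : ∀ {n} → Fin n → Fin n → Carrier → Carrier → Fin n → Carrier
  pairVector p q u v j with j ≟ p | j ≟ q
  ... | yes _ | _ = u
  ... | no _ | yes _ = v
  ... | no _ | no _ = 0#

  pairVector-at₁ : ∀ {n} (p q : Fin n) u v → pairVector p q u v p ≈ u
  pairVector-at₁ p q u v with p ≟ p
  ... | yes _ = refl
  ... | no p≢p = ⊥-elim (p≢p ≡.refl)

  pairVector-at₂ : ∀ {n} (p q : Fin n) u v → p ≢ q → pairVector p q u v q ≈ v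
  pairVector-at₂ p q u v p≢q with q ≟ p | q ≟ q
  ... | yes q≡p | _ = ⊥-elim (p≢q (≡.sym q≡p))
  ... | no _ | yes _ = refl
  ... | no _ | no q≢q = ⊥-elim (q≢q ≡.refl)

  pairVector-off : ∀ {n} (p q : Fin n) u v {j} → j ≢ p → j ≢ q → pairVector p q u v j ≈ 0#
  pairVector-off p q u v {j} j≢p j≢q with j ≟ p | j ≟ q
  ... | yes j≡p | _ = ⊥-elim (j≢p j≡p)
  ... | no _ | yes j≡q = ⊥-elim (j≢q j≡q)
  ... | no _ | no _ = refl

-- K and K/H are both tracts on the carrier and multiplication of K; only these laws of them are used.
module TractOverField {c ℓ ℓₜ} (K : Field c ℓ)
  (Eqₜ : Field.Carrier K → Field.Carrier K → Set ℓₜ)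
  (Null : ∀ {k} → (Fin k → Field.Carrier K) → Set (c ⊔ ℓₜ)) where
  open Field K

  infix 4 _≈ₜ_
  _≈ₜ_ : Carrier → Carrier → Set ℓₜ
  _≈ₜ_ = Eqₜ

  tract : Tract c ℓₜ
  tract = record { Carrier = Carrier ; _≈_ = _≈ₜ_ ; 0# = 0# ; _*_ = _*_ ; Null = Null }

  record Laws : Set (c ⊔ ℓ ⊔ ℓₜ) where
    field
      ≈ₜ-sym       : ∀ {x y} → x ≈ₜ y → y ≈ₜ x
      ≈ₜ-trans     : ∀ {x y z} → x ≈ₜ y → y ≈ₜ z → x ≈ₜ z
      ≈⇒≈ₜ         : ∀ {x y} → x ≈ y → x ≈ₜ y
      ≈ₜ0⇒≈0       : ∀ {x} → x ≈ₜ 0# → x ≈ 0#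
      *-congˡₜ     : ∀ a {x y} → x ≈ₜ y → a * x ≈ₜ a * y
      Σ≈0⇒Null     : ∀ {k} {x : Fin k → Carrier} → Σ[ K ] x ≈ 0# → Null x
      Null-resp    : ∀ {k} {x y : Fin k → Carrier} → (∀ j → x j ≈ₜ y j) → Null x → Null y
      Null-scale   : ∀ {k} a {x : Fin k → Carrier} → Null x → Null (λ j → a * x j)
      Null-permute : ∀ {k} {f : Fin k → Fin k} → Injective _≡_ _≡_ f →
                     {x : Fin k → Carrier} → Null x → Null (λ j → x (f j))
      pairNull⇒cross≈ₜ : ∀ {k} {x y : Fin k → Carrier} p q → p ≢ q →
                         (∀ j → j ≢ p → j ≢ q → (x j ≈ 0#) × (y j ≈ 0#)) →
                         Null x → Null y → y q * x p ≈ₜ y p * x q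

module LawfulTract {c ℓ ℓₜ} {K : Field c ℓ}
  {Eqₜ : Field.Carrier K → Field.Carrier K → Set ℓₜ}
  {Null : ∀ {k} → (Fin k → Field.Carrier K) → Set (c ⊔ ℓₜ)}
  (laws : TractOverField.Laws K Eqₜ Null) where
  open Field K
  open FieldProperties K
  open TractOverField K Eqₜ Null
  open Laws laws
  open OverTract tract

  ≉ₜ0⇒≉0 : ∀ {a} → ¬ (a ≈ₜ 0#) → ¬ (a ≈ 0#)
  ≉ₜ0⇒≉0 a≉ₜ0 a≈0 = a≉ₜ0 (≈⇒≈ₜ a≈0)

  ≉0⇒≉ₜ0 : ∀ {a} → ¬ (a ≈ 0#) → ¬ (a ≈ₜ 0#)
  ≉0⇒≉ₜ0 a≉0 a≈ₜ0 = a≉0 (≈ₜ0⇒≈0 a≈ₜ0)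

  *-congʳₜ : ∀ a {x y} → x ≈ₜ y → x * a ≈ₜ y * a
  *-congʳₜ a {x} {y} x≈ₜy = ≈ₜ-trans (≈⇒≈ₜ (*-comm x a)) (≈ₜ-trans (*-congˡₜ a x≈ₜy) (≈⇒≈ₜ (*-comm a y)))

  *-cancelˡₜ : ∀ {u x y} → ¬ (u ≈ 0#) → u * x ≈ₜ u * y → x ≈ₜ y
  *-cancelˡₜ {u} {x} {y} u≉0 ux≈ₜuy =
    ≈ₜ-trans (≈⇒≈ₜ (sym (⁻¹-cancelˡ u u≉0 x)))
      (≈ₜ-trans (*-congˡₜ (u ⁻¹⟨ u≉0 ⟩) ux≈ₜuy) (≈⇒≈ₜ (⁻¹-cancelˡ u u≉0 y)))

  SuppIs-resp : ∀ {n} {X Y : Vector n} {S} → X ≋ Y → SuppIs X S → SuppIs Y S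
  SuppIs-resp X≋Y supp i = (λ i∈S Yi≈0 → proj₁ (supp i) i∈S (≈ₜ-trans (X≋Y i) Yi≈0))
                         , (λ i∉S → ≈ₜ-trans (≈ₜ-sym (X≋Y i)) (proj₂ (supp i) i∉S))

  SuppIs-scale : ∀ {n a} {X : Vector n} {S} → ¬ (a ≈ₜ 0#) → SuppIs X S → SuppIs (scale a X) S
  SuppIs-scale {a = a} a≉0 supp i =
      (λ i∈S aXi≈0 → *-nonzero (≉ₜ0⇒≉0 a≉0) (≉ₜ0⇒≉0 (proj₁ (supp i) i∈S)) (≈ₜ0⇒≈0 aXi≈0))
    , (λ i∉S → ≈⇒≈ₜ (x≈0⇒y*x≈0 a (≈ₜ0⇒≈0 (proj₂ (supp i) i∉S))))

  ¬¬-support : ∀ {n} (X : Vector n) → ¬¬ ∃ (SuppIs X)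
  ¬¬-support X = ¬¬-bind (¬¬-∀-Fin (λ j → ¬¬-excluded-middle)) λ zero? →
    ¬¬-pure (∁ (satisfying zero?) , λ i →
        (λ i∈ → ∉-satisfying⁻ zero? (x∈∁p⇒x∉p i∈))
      , (λ i∉ → ∈-satisfying⁻ zero? (x∉∁p⇒x∈p i∉)))

  nonzero⇒∈supp : ∀ {n} {X : Vector n} {C j} → SuppIs X C → ¬ (X j ≈ₜ 0#) → j ∈ C
  nonzero⇒∈supp {C = C} {j} supp Xj≉0 = decidable-stable (j ∈? C) (λ j∉C → Xj≉0 (proj₂ (supp j) j∉C))

  unitVector-support : ∀ {n} {S} {p : Fin n} → p ∈ S → (∀ r → r ∈ S → r ≡ p) → SuppIs (unitVector p) S
  unitVector-support {S = S} {p} p∈S onlyP i =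
      (λ i∈S → ≉0⇒≉ₜ0 λ δpi≈0 → 1≉0 (trans (sym (unitVector-at p))
                 (≡.subst (λ k → unitVector p k ≈ 0#) (onlyP i i∈S) δpi≈0)))
    , (λ i∉S → ≈⇒≈ₜ (unitVector-off {p = p} {i} λ { ≡.refl → i∉S p∈S }))

  Proportional : ∀ {n} → Vector n → Vector n → Set (c ⊔ ℓₜ)
  Proportional X Y = ∃ λ a → ¬ (a ≈ₜ 0#) × (Y ≋ scale a X)

  proportionalOnPair : ∀ {n} {X Y : Vector n} p q → ¬ (X p ≈ₜ 0#) → ¬ (Y p ≈ₜ 0#) →
                       (∀ j → j ≢ p → j ≢ q → (X j ≈ₜ 0#) × (Y j ≈ₜ 0#)) →
                       Y q * X p ≈ₜ Y p * X q → Proportional X Y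
  proportionalOnPair {X = X} {Y} p q Xp≉0 Yp≉0 vanish cross =
    a , ≉0⇒≉ₜ0 (*-nonzero (≉ₜ0⇒≉0 Yp≉0) (⁻¹-nonzero _ Xp≉0′)) , Y≋aX
    where
    Xp≉0′ : ¬ (X p ≈ 0#)
    Xp≉0′ = ≉ₜ0⇒≉0 Xp≉0
    Xp⁻¹ a : Carrier
    Xp⁻¹ = X p ⁻¹⟨ Xp≉0′ ⟩
    a = Y p * Xp⁻¹
    Y≋aX : ∀ i → Y i ≈ₜ a * X i
    Y≋aX i with i ≟ p | i ≟ q
    ... | yes ≡.refl | _ = ≈⇒≈ₜ (x≈[x*y⁻¹]*y (Y p) (X p) Xp≉0′)
    ... | no _ | yes ≡.refl =
      ≈ₜ-trans (≈⇒≈ₜ (sym (trans (x∙yz≈y∙xz Xp⁻¹ (Y q) (X p))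
                                 (trans (*-congˡ (⁻¹-inverseˡ (X p) Xp≉0′)) (*-identityʳ (Y q))))))
               (≈ₜ-trans (*-congˡₜ Xp⁻¹ cross) (≈⇒≈ₜ (x∙yz≈yx∙z Xp⁻¹ (Y p) (X q))))
    ... | no i≢p | no i≢q = ≈ₜ-trans (proj₂ (vanish i i≢p i≢q))
                              (≈⇒≈ₜ (sym (x≈0⇒y*x≈0 a (≈ₜ0⇒≈0 (proj₁ (vanish i i≢p i≢q))))))

  orthogonalOnPair⇒cross≈ₜ : ∀ {n} {cc X Y : Vector n} p q → p ≢ q →
                             ¬ (cc p ≈ 0#) → ¬ (cc q ≈ 0#) →
                             (∀ j → j ≢ p → j ≢ q → (X j ≈ₜ 0#) × (Y j ≈ₜ 0#)) →
                             Orth cc X → Orth cc Y → Y q * X p ≈ₜ Y p * X q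
  orthogonalOnPair⇒cross≈ₜ {cc = cc} {X} {Y} p q p≢q ccp≉0 ccq≉0 vanish cc⊥X cc⊥Y =
    *-cancelˡₜ (*-nonzero ccp≉0 ccq≉0)
      (≈ₜ-trans (≈⇒≈ₜ (trans (*-congʳ (*-comm (cc p) (cc q))) (sym (interchange _ _ _ _))))
        (≈ₜ-trans (pairNull⇒cross≈ₜ p q p≢q vanish′ cc⊥X cc⊥Y) (≈⇒≈ₜ (interchange _ _ _ _))))
    where
    vanish′ : ∀ j → j ≢ p → j ≢ q → (cc j * X j ≈ 0#) × (cc j * Y j ≈ 0#)
    vanish′ j j≢p j≢q = x≈0⇒y*x≈0 (cc j) (≈ₜ0⇒≈0 (proj₁ (vanish j j≢p j≢q)))
                      , x≈0⇒y*x≈0 (cc j) (≈ₜ0⇒≈0 (proj₂ (vanish j j≢p j≢q)))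

  SupportedAtOnePoint : ∀ {n} → Vector n → Set (c ⊔ ℓₜ)
  SupportedAtOnePoint X = Lift c (∃ λ p → ¬ (X p ≈ₜ 0#) × (∀ j → j ≢ p → X j ≈ₜ 0#))

  freeTMatroid : (n : ℕ) → TMatroid n n
  freeTMatroid n = record
    { underlying = freeMatroid n
    ; 𝒞 = λ _ → Lift (c ⊔ ℓₜ) Empty
    ; 𝒞* = SupportedAtOnePoint
    ; 𝒞-resp = λ _ ()
    ; 𝒞*-resp = λ { X≋Y (lift (p , Xp≉0 , vanish)) →
        lift (p , (λ Yp≈0 → Xp≉0 (≈ₜ-trans (X≋Y p) Yp≈0)) ,
              λ j j≢p → ≈ₜ-trans (≈ₜ-sym (X≋Y j)) (vanish j j≢p)) }
    ; 𝒞-scale = λ _ ()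
    ; 𝒞*-scale = λ { {a} a≉0 (lift (p , Xp≉0 , vanish)) →
        lift (p , ≉0⇒≉ₜ0 (*-nonzero (≉ₜ0⇒≉0 a≉0) (≉ₜ0⇒≉0 Xp≉0)) ,
              λ j j≢p → ≈⇒≈ₜ (x≈0⇒y*x≈0 a (≈ₜ0⇒≈0 (vanish j j≢p)))) }
    ; 𝒞-supp = λ ()
    ; 𝒞*-supp = λ { {X} (lift (p , Xp≉0 , vanish)) →
        ⁅ p ⁆ , support X p Xp≉0 vanish , freeMatroid-⁅⁆-cocircuit p }
    ; 𝒞-exists = λ circuit → ⊥-elim (freeMatroid-noCircuit circuit)
    ; 𝒞*-exists = cocircuitVector
    ; 𝒞-unique = λ ()
    ; 𝒞*-unique = proportional
    ; orthogonal = λ ()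
    }
    where
    support : ∀ X p → ¬ (X p ≈ₜ 0#) → (∀ j → j ≢ p → X j ≈ₜ 0#) → SuppIs X ⁅ p ⁆
    support X p Xp≉0 vanish i =
        (λ i∈⁅p⁆ → ≡.subst (λ k → ¬ (X k ≈ₜ 0#)) (≡.sym (x∈⁅y⁆⇒x≡y p i∈⁅p⁆)) Xp≉0)
      , (λ i∉⁅p⁆ → vanish i (x∉⁅y⁆⇒x≢y i∉⁅p⁆))
    cocircuitVector : ∀ {S} → IsCocircuit (freeMatroid n) S → ∃ λ X → SupportedAtOnePoint X × SuppIs X S
    cocircuitVector cocircuit with freeMatroid-cocircuit⇒singleton cocircuit
    ... | p , p∈S , onlyP = unitVector p
        , lift (p , ≉0⇒≉ₜ0 (λ δpp≈0 → 1≉0 (trans (sym (unitVector-at p)) δpp≈0))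
               , λ j j≢p → ≈⇒≈ₜ (unitVector-off j≢p))
        , unitVector-support p∈S onlyP
    proportional : ∀ {X Y} → SupportedAtOnePoint X → SupportedAtOnePoint Y → SameSupp X Y → Proportional X Y
    proportional (lift (p , Xp≉0 , vanishX)) (lift (p′ , Yp′≉0 , vanishY)) sameSupp with p′ ≟ p
    ... | yes ≡.refl = proportionalOnPair p p Xp≉0 Yp′≉0 (λ j j≢p _ → vanishX j j≢p , vanishY j j≢p)
                         (≈⇒≈ₜ refl)
    ... | no p′≢p = ⊥-elim (Yp′≉0 (proj₁ (sameSupp p′) (vanishX p′ p′≢p)))

  module SingleCircuit {n} (cv : Vector n) {C} (cv-supp : SuppIs cv C) {j₀} (j₀∈C : j₀ ∈ C) where
    open SingleCircuitMatroid C j₀∈C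
      using (matroid; C-isCircuit; circuit⇒≐C; CocircuitShape; singleton; pair; cocircuit-shape)

    IsMultiple : Vector n → Set (c ⊔ ℓₜ)
    IsMultiple X = ∃ λ a → ¬ (a ≈ₜ 0#) × (∀ i → X i ≈ₜ a * cv i)

    IsCocircuitVector : Vector n → Set (c ⊔ ℓₜ)
    IsCocircuitVector Y = ∃ λ S → SuppIs Y S × IsCocircuit matroid S × Orth cv Y

    private
      cv-nonzero : ∀ {i} → i ∈ C → ¬ (cv i ≈ 0#)
      cv-nonzero i∈C = ≉ₜ0⇒≉0 (proj₁ (cv-supp _) i∈C)
      cv-zero : ∀ {i} → i ∉ C → cv i ≈ 0#
      cv-zero i∉C = ≈ₜ0⇒≈0 (proj₂ (cv-supp _) i∉C)

    cocircuitVector : ∀ {S} → IsCocircuit matroid S → ∃ λ Y → IsCocircuitVector Y × SuppIs Y S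
    cocircuitVector {S} cocircuit with cocircuit-shape cocircuit
    ... | singleton p p∉C p∈S onlyP = unitVector p , (S , supp , cocircuit , cv⊥δp) , supp
      where
      supp : SuppIs (unitVector p) S
      supp = unitVector-support p∈S onlyP
      cv⊥δp : Orth cv (unitVector p)
      cv⊥δp = Σ≈0⇒Null (trans (Σ-single _ p (λ j j≢p → x≈0⇒y*x≈0 (cv j) (unitVector-off j≢p)))
                               (x≈0⇒x*y≈0 _ (cv-zero p∉C)))
    ... | pair p q p∈C q∈C p≢q p∈S q∈S onlyPQ = Y , (S , supp , cocircuit , cv⊥Y) , supp
      where
      Y : Vector n
      Y = pairVector p q (cv q) (- cv p)
      supp : SuppIs Y S
      supp i = nonzeroOnS , (λ i∉S → ≈⇒≈ₜ (pairVector-off p q (cv q) (- cv p) {i} (λ { ≡.refl → i∉S p∈S })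
                                                               (λ { ≡.refl → i∉S q∈S })))
        where
        nonzeroOnS : i ∈ S → ¬ (Y i ≈ₜ 0#)
        nonzeroOnS i∈S with onlyPQ i i∈S
        ... | inj₁ ≡.refl = ≉0⇒≉ₜ0 λ Yp≈0 → cv-nonzero q∈C (trans (sym (pairVector-at₁ p q _ _)) Yp≈0)
        ... | inj₂ ≡.refl = ≉0⇒≉ₜ0 λ Yq≈0 → -‿nonzero (cv-nonzero p∈C)
                                                (trans (sym (pairVector-at₂ p q _ _ p≢q)) Yq≈0)
      cv⊥Y : Orth cv Y
      cv⊥Y = Σ≈0⇒Null (begin
        Σ[ K ] (λ j → cv j * Y j)
          ≈⟨ Σ-pair _ p q p≢q (λ j j≢p j≢q → x≈0⇒y*x≈0 (cv j) (pairVector-off p q _ _ j≢p j≢q)) ⟩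
        cv p * Y p + cv q * Y q
          ≈⟨ +-cong (*-congˡ (pairVector-at₁ p q _ _)) (*-congˡ (pairVector-at₂ p q _ _ p≢q)) ⟩
        cv p * cv q + cv q * - cv p ≈⟨ x*y+y*-x≈0 (cv p) (cv q) ⟩
        0#                          ∎)
        where open import Relation.Binary.Reasoning.Setoid setoid

    cocircuitVector-unique : ∀ {X Y} → IsCocircuitVector X → IsCocircuitVector Y → SameSupp X Y →
                             Proportional X Y
    cocircuitVector-unique {X} {Y} (S , X-supp , cocircuit , cv⊥X) (_ , _ , _ , cv⊥Y) sameSupp
      with cocircuit-shape cocircuit
    ... | singleton p _ p∈S onlyP =
      proportionalOnPair p p Xp≉0 (λ Yp≈0 → Xp≉0 (proj₂ (sameSupp p) Yp≈0))
        (λ j j≢p _ → vanish j (j≢p ∘′ onlyP j)) (≈⇒≈ₜ refl)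
      where
      Xp≉0 : ¬ (X p ≈ₜ 0#)
      Xp≉0 = proj₁ (X-supp p) p∈S
      vanish : ∀ j → j ∉ S → (X j ≈ₜ 0#) × (Y j ≈ₜ 0#)
      vanish j j∉S = proj₂ (X-supp j) j∉S , proj₁ (sameSupp j) (proj₂ (X-supp j) j∉S)
    ... | pair p q p∈C q∈C p≢q p∈S q∈S onlyPQ =
      proportionalOnPair p q Xp≉0 (λ Yp≈0 → Xp≉0 (proj₂ (sameSupp p) Yp≈0)) vanishOff
        (orthogonalOnPair⇒cross≈ₜ p q p≢q (cv-nonzero p∈C) (cv-nonzero q∈C) vanishOff cv⊥X cv⊥Y)
      where
      Xp≉0 : ¬ (X p ≈ₜ 0#)
      Xp≉0 = proj₁ (X-supp p) p∈S
      vanishOff : ∀ j → j ≢ p → j ≢ q → (X j ≈ₜ 0#) × (Y j ≈ₜ 0#)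
      vanishOff j j≢p j≢q = Xj≈0 , proj₁ (sameSupp j) Xj≈0
        where
        Xj≈0 : X j ≈ₜ 0#
        Xj≈0 = proj₂ (X-supp j) (λ j∈S → [ j≢p , j≢q ]′ (onlyPQ j j∈S))

    orth⇒multiple-orth : ∀ {a X Y} → (∀ i → X i ≈ₜ a * cv i) → Orth cv Y → Orth X Y
    orth⇒multiple-orth {a} {Y = Y} X≈acv cv⊥Y =
      Null-resp (λ j → ≈ₜ-sym (≈ₜ-trans (*-congʳₜ (Y j) (X≈acv j)) (≈⇒≈ₜ (*-assoc a (cv j) (Y j)))))
        (Null-scale a cv⊥Y)

    tmatroid : TMatroid n (n ∸ 1)
    tmatroid = record
      { underlying = matroid
      ; 𝒞 = IsMultiple
      ; 𝒞* = IsCocircuitVector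
      ; 𝒞-resp = λ { X≋Y (a , a≉0 , X≈acv) → a , a≉0 , λ i → ≈ₜ-trans (≈ₜ-sym (X≋Y i)) (X≈acv i) }
      ; 𝒞*-resp = λ { X≋Y (S , supp , cocircuit , cv⊥X) →
          S , SuppIs-resp X≋Y supp , cocircuit , Null-resp (λ j → *-congˡₜ (cv j) (X≋Y j)) cv⊥X }
      ; 𝒞-scale = λ { {b} b≉0 (a , a≉0 , X≈acv) →
          b * a , ≉0⇒≉ₜ0 (*-nonzero (≉ₜ0⇒≉0 b≉0) (≉ₜ0⇒≉0 a≉0)) ,
          λ i → ≈ₜ-trans (*-congˡₜ b (X≈acv i)) (≈⇒≈ₜ (sym (*-assoc b a (cv i)))) }
      ; 𝒞*-scale = λ { {a} {X} a≉0 (S , supp , cocircuit , cv⊥X) →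
          S , SuppIs-scale a≉0 supp , cocircuit ,
          Null-resp (λ j → ≈⇒≈ₜ (x∙yz≈y∙xz a (cv j) (X j))) (Null-scale a cv⊥X) }
      ; 𝒞-supp = λ { (a , a≉0 , X≈acv) → C , multiple-supp a≉0 X≈acv , C-isCircuit }
      ; 𝒞*-supp = λ { (S , supp , cocircuit , _) → S , supp , cocircuit }
      ; 𝒞-exists = λ circuit → cv , (1# , ≉0⇒≉ₜ0 1≉0 , λ i → ≈⇒≈ₜ (sym (*-identityˡ (cv i))))
                             , λ i → (λ i∈S → proj₁ (cv-supp i) (proj₁ (circuit⇒≐C circuit i) i∈S))
                                   , (λ i∉S → proj₂ (cv-supp i) (i∉S ∘′ proj₂ (circuit⇒≐C circuit i)))
      ; 𝒞*-exists = cocircuitVector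
      ; 𝒞-unique = λ { (a , a≉0 , X≈acv) (b , b≉0 , Y≈bcv) _ → multiples-proportional a≉0 X≈acv b≉0 Y≈bcv }
      ; 𝒞*-unique = cocircuitVector-unique
      ; orthogonal = λ { (a , a≉0 , X≈acv) (_ , _ , _ , cv⊥Y) → orth⇒multiple-orth X≈acv cv⊥Y }
      }
      where
      multiple-supp : ∀ {a X} → ¬ (a ≈ₜ 0#) → (∀ i → X i ≈ₜ a * cv i) → SuppIs X C
      multiple-supp {a} a≉0 X≈acv i =
          (λ i∈C Xi≈0 → *-nonzero (≉ₜ0⇒≉0 a≉0) (cv-nonzero i∈C) (≈ₜ0⇒≈0 (≈ₜ-trans (≈ₜ-sym (X≈acv i)) Xi≈0)))
        , (λ i∉C → ≈ₜ-trans (X≈acv i) (≈⇒≈ₜ (x≈0⇒y*x≈0 a (cv-zero i∉C))))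
      multiples-proportional : ∀ {a b X Y} → ¬ (a ≈ₜ 0#) → (∀ i → X i ≈ₜ a * cv i) →
                               ¬ (b ≈ₜ 0#) → (∀ i → Y i ≈ₜ b * cv i) → Proportional X Y
      multiples-proportional {a} {b} a≉0 X≈acv b≉0 Y≈bcv =
        b * a⁻¹ , ≉0⇒≉ₜ0 (*-nonzero (≉ₜ0⇒≉0 b≉0) (⁻¹-nonzero a a≉0′)) ,
        λ i → ≈ₜ-trans (Y≈bcv i)
                (≈ₜ-trans (≈⇒≈ₜ (sym (trans (*-assoc b a⁻¹ _) (*-congˡ (⁻¹-cancelˡ a a≉0′ (cv i))))))
                  (*-congˡₜ (b * a⁻¹) (≈ₜ-sym (X≈acv i))))
        where
        a≉0′ : ¬ (a ≈ 0#)
        a≉0′ = ≉ₜ0⇒≉0 a≉0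
        a⁻¹ : Carrier
        a⁻¹ = a ⁻¹⟨ a≉0′ ⟩

    orth⇒covector : ∀ {Y} → Orth cv Y → Covector tmatroid Y
    orth⇒covector cv⊥Y X (a , _ , X≈acv) = orth⇒multiple-orth X≈acv cv⊥Y

  ¬¬-nonzeroCircuit : ∀ {n s} (M : TMatroid n s) → s < n →
                      ¬¬ ∃ λ X → 𝒞 M X × ∃ λ j → ¬ (X j ≈ₜ 0#)
  ¬¬-nonzeroCircuit M s<n = ¬¬-bind (rank<n⇒¬¬circuit (underlying M) s<n) λ (C , circuit) →
    let X , X∈𝒞 , X-supp = 𝒞-exists M circuit
        j , j∈C = circuit-nonempty (Matroid.nonempty (underlying M)) circuit
    in ¬¬-pure (X , X∈𝒞 , j , proj₁ (X-supp j) j∈C)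

  module Ranks {m n : ℕ} (A : Matrix m n) where

    ColumnsDependent : Set (c ⊔ ℓₜ)
    ColumnsDependent = LinDep (column A)

    reindex-dependent : ∀ {f : Fin n → Fin n} → Injective _≡_ _≡_ f →
                        ColumnsDependent → LinDep (λ j → column A (f j))
    reindex-dependent {f} inj (a , (j₀ , aj₀≉0) , null) =
      (λ j → a (f j)) ,
      (proj₁ (injective⇒surjective inj j₀) ,
       ≡.subst (λ k → ¬ (a k ≈ₜ 0#)) (≡.sym (proj₂ (injective⇒surjective inj j₀))) aj₀≉0) ,
      λ i → Null-permute inj (null i)

    colRank⇔independent : ColRank A n ⇔ (¬ ColumnsDependent)
    colRank⇔independent = mk⇔
      (λ ((f , inj , independent) , _) dependent → independent (reindex-dependent inj dependent))
      (λ independent → ((λ j → j) , (λ {_} {_} eq → eq) , independent) ,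
                       λ _ (_ , inj , _) → FinP.injective⇒≤ inj)

    ¬¬-colRank : ¬¬ ∃ (ColRank A)
    ¬¬-colRank = ¬¬-∃-greatest (HasIndepCols A) n
      ((λ ()) , (λ { {()} }) , λ { (_ , (() , _) , _) })
      (λ _ (_ , inj , _) → FinP.injective⇒≤ inj)

    lowRank⇒¬¬dependent : ∀ {s} (M : TMatroid n s) → s < n → (∀ i → Covector M (A i)) →
                          ¬¬ ColumnsDependent
    lowRank⇒¬¬dependent M s<n rowsCovectors = ¬¬-bind (¬¬-nonzeroCircuit M s<n) λ (X , X∈𝒞 , nonzero) →
      ¬¬-pure (X , nonzero , λ i → rowsCovectors i X X∈𝒞)

    dependent⇒¬¬corank1 : ColumnsDependent → ¬¬ HasMatroid A (n ∸ 1)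
    dependent⇒¬¬corank1 (a , (j₀ , aj₀≉0) , a⊥rows) = ¬¬-bind (¬¬-support a) λ (C , a-supp) →
      let open SingleCircuit a a-supp (nonzero⇒∈supp a-supp aj₀≉0)
      in ¬¬-pure (tmatroid , λ i → orth⇒covector (a⊥rows i))

    matRank⇔independent : MatRank A n ⇔ (¬ ColumnsDependent)
    matRank⇔independent = mk⇔ rank≡n⇒independent independent⇒rank≡n
      where
      rank≡n⇒independent : MatRank A n → ¬ ColumnsDependent
      rank≡n⇒independent (_ , minimal) dependent@(_ , (j₀ , _) , _) =
        dependent⇒¬¬corank1 dependent λ corank1 →
          ℕP.<⇒≱ (Fin⇒n∸1<n j₀) (minimal (n ∸ 1) corank1)
      independent⇒rank≡n : ¬ ColumnsDependent → MatRank A n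
      independent⇒rank≡n independent = (freeTMatroid n , λ i X ()) ,
        λ s (M , rowsCovectors) → ℕP.≮⇒≥ λ s<n → lowRank⇒¬¬dependent M s<n rowsCovectors independent

module TractsOfQuotient {c ℓ} (K : Field c ℓ) (S : Subgroup× K) where
  open Field K
  open FieldProperties K
  open Subgroup× S
  open Quotient K S
  open import Relation.Binary.Reasoning.Setoid setoid

  module OverK = TractOverField K _≈_ (λ x → Lift c (Σ[ K ] x ≈ 0#))
  module OverF = TractOverField K _≈F_ NullF

  K-laws : OverK.Laws
  K-laws = record
    { ≈ₜ-sym = sym ; ≈ₜ-trans = trans ; ≈⇒≈ₜ = λ x≈y → x≈y ; ≈ₜ0⇒≈0 = λ x≈0 → x≈0
    ; *-congˡₜ = λ _ → *-congˡ
    ; Σ≈0⇒Null = lift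
    ; Null-resp = λ x≈y (lift Σx≈0) → lift (trans (sym (Σ-cong x≈y)) Σx≈0)
    ; Null-scale = λ { a {x} (lift Σx≈0) → lift (trans (sym (*-distribˡ-Σ a x)) (x≈0⇒y*x≈0 a Σx≈0)) }
    ; Null-permute = λ { inj {x} (lift Σx≈0) → lift (trans (Σ-permute inj x) Σx≈0) }
    ; pairNull⇒cross≈ₜ = λ { {x = x} {y} p q p≢q vanish (lift Σx≈0) (lift Σy≈0) →
        x₁+x₂≈0∧y₁+y₂≈0⇒y₂*x₁≈y₁*x₂
          (trans (sym (Σ-pair x p q p≢q (λ j j≢p j≢q → proj₁ (vanish j j≢p j≢q)))) Σx≈0)
          (trans (sym (Σ-pair y p q p≢q (λ j j≢p j≢q → proj₂ (vanish j j≢p j≢q)))) Σy≈0) }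
    }

  infix 4 _∈H·_
  _∈H·_ : Carrier → Carrier → Set (c ⊔ ℓ)
  x ∈H· y = ∃ λ h → H h × x ≈ h * y

  ≈F⇒∈H· : ∀ {x y} → x ≈F y → x ∈H· y
  ≈F⇒∈H· (inj₁ (x≈0 , y≈0)) = 1# , H-one , trans x≈0 (sym (x≈0⇒y*x≈0 1# y≈0))
  ≈F⇒∈H· (inj₂ x∈Hy) = x∈Hy

  ∈H·-sym : ∀ {x y} → x ∈H· y → y ∈H· x
  ∈H·-sym {x} {y} (h , h∈H , x≈hy) with H-inv h∈H
  ... | h⁻¹ , h⁻¹∈H , hh⁻¹≈1 = h⁻¹ , h⁻¹∈H , (begin
    y              ≈⟨ *-identityˡ y ⟨
    1# * y         ≈⟨ *-congʳ (trans (*-comm h⁻¹ h) hh⁻¹≈1) ⟨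
    (h⁻¹ * h) * y  ≈⟨ *-assoc _ _ _ ⟩
    h⁻¹ * (h * y)  ≈⟨ *-congˡ x≈hy ⟨
    h⁻¹ * x        ∎)

  ∈H·-trans : ∀ {x y z} → x ∈H· y → y ∈H· z → x ∈H· z
  ∈H·-trans (h , h∈H , x≈hy) (g , g∈H , y≈gz) =
    h * g , H-mul h∈H g∈H , trans x≈hy (trans (*-congˡ y≈gz) (sym (*-assoc h g _)))

  ≈F0⇒≈0 : ∀ {x} → x ≈F 0# → x ≈ 0#
  ≈F0⇒≈0 x≈F0 = let h , _ , x≈h0 = ≈F⇒∈H· x≈F0 in trans x≈h0 (zeroʳ h)

  NullF-resp : ∀ {k} {x y : Fin k → Carrier} → (∀ j → x j ≈F y j) → NullF x → NullF y
  NullF-resp {k} {x} {y} x≈Fy (h , h∈H , Σhx≈0) =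
    (λ j → h j * factor j) , (λ j → H-mul (h∈H j) (factor∈H j)) ,
    trans (Σ-cong λ j → trans (*-assoc _ _ _) (*-congˡ (sym (x≈factor*y j)))) Σhx≈0
    where
    factor : Fin k → Carrier
    factor j = proj₁ (≈F⇒∈H· (x≈Fy j))
    factor∈H : ∀ j → H (factor j)
    factor∈H j = proj₁ (proj₂ (≈F⇒∈H· (x≈Fy j)))
    x≈factor*y : ∀ j → x j ≈ factor j * y j
    x≈factor*y j = proj₂ (proj₂ (≈F⇒∈H· (x≈Fy j)))

  NullF-scale : ∀ {k} a {x : Fin k → Carrier} → NullF x → NullF (λ j → a * x j)
  NullF-scale a {x} (h , h∈H , Σhx≈0) = h , h∈H ,
    trans (Σ-cong (λ j → x∙yz≈y∙xz (h j) a (x j)))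
          (trans (sym (*-distribˡ-Σ a (λ j → h j * x j))) (x≈0⇒y*x≈0 a Σhx≈0))

  -- The two cross products differ by the factor (k p * h q) / (k q * h p) ∈ H,
  -- where h and k are the weights of the two null sums.
  pairNullF⇒cross≈F : ∀ {k} {x y : Fin k → Carrier} p q → p ≢ q →
                      (∀ j → j ≢ p → j ≢ q → (x j ≈ 0#) × (y j ≈ 0#)) →
                      NullF x → NullF y → (y q * x p) ≈F (y p * x q)
  pairNullF⇒cross≈F {x = x} {y} p q p≢q vanish (h , h∈H , Σhx≈0) (k , k∈H , Σky≈0) =
    inj₂ (∈H·-trans (∈H·-sym (u , u∈H , refl)) (v , H-mul (k∈H p) (h∈H q) , u-cross≈v-cross))
    where
    u v : Carrier
    u = k q * h p
    v = k p * h q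
    u∈H : H u
    u∈H = H-mul (k∈H q) (h∈H p)
    weighted : (k q * y q) * (h p * x p) ≈ (k p * y p) * (h q * x q)
    weighted = x₁+x₂≈0∧y₁+y₂≈0⇒y₂*x₁≈y₁*x₂
      (trans (sym (Σ-pair _ p q p≢q (λ j j≢p j≢q → x≈0⇒y*x≈0 (h j) (proj₁ (vanish j j≢p j≢q))))) Σhx≈0)
      (trans (sym (Σ-pair _ p q p≢q (λ j j≢p j≢q → x≈0⇒y*x≈0 (k j) (proj₂ (vanish j j≢p j≢q))))) Σky≈0)
    u-cross≈v-cross : u * (y q * x p) ≈ v * (y p * x q)
    u-cross≈v-cross = trans (sym (interchange _ _ _ _)) (trans weighted (interchange _ _ _ _))

  ≈⇒≈F : ∀ {x y} → x ≈ y → x ≈F y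
  ≈⇒≈F x≈y = inj₂ (1# , H-one , trans x≈y (sym (*-identityˡ _)))

  F-laws : OverF.Laws
  F-laws = record
    { ≈ₜ-sym = λ x≈Fy → inj₂ (∈H·-sym (≈F⇒∈H· x≈Fy))
    ; ≈ₜ-trans = λ x≈Fy y≈Fz → inj₂ (∈H·-trans (≈F⇒∈H· x≈Fy) (≈F⇒∈H· y≈Fz))
    ; ≈⇒≈ₜ = ≈⇒≈F
    ; ≈ₜ0⇒≈0 = ≈F0⇒≈0
    ; *-congˡₜ = λ a x≈Fy → let h , h∈H , x≈hy = ≈F⇒∈H· x≈Fy in
        inj₂ (h , h∈H , trans (*-congˡ x≈hy) (x∙yz≈y∙xz a h _))
    ; Σ≈0⇒Null = λ { {x = x} Σx≈0 →
        (λ _ → 1#) , (λ _ → H-one) , trans (Σ-cong (λ j → *-identityˡ (x j))) Σx≈0 }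
    ; Null-resp = NullF-resp
    ; Null-scale = NullF-scale
    ; Null-permute = λ { {f = f} inj (h , h∈H , Σhx≈0) →
        (λ j → h (f j)) , (λ j → h∈H (f j)) , trans (Σ-permute inj _) Σhx≈0 }
    ; pairNull⇒cross≈ₜ = pairNullF⇒cross≈F
    }

module FourRanks {c ℓ} (K : Field c ℓ) (S : Subgroup× K) {m n : ℕ}
                 (A : OverTract.Matrix (Quotient.quotientTract K S) m n) where
  open Field K
  open FieldProperties K
  open Quotient K S
  open TractsOfQuotient K S
  open Phi K S using (Lifts; LiftRank; PushCovector; PhiMatRank)
  module KT = OverTract (fieldTract K)
  module PK = LawfulTract K-laws
  module PF = LawfulTract F-laws
  open PF.Ranks A public using (ColumnsDependent; colRank⇔independent; matRank⇔independent)
  open OverF.Laws F-laws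

  lift-dependent⇒dependent : ∀ {A′} → Lifts A′ A → KT.LinDep (KT.column A′) → ColumnsDependent
  lift-dependent⇒dependent A′≈FA (a , (j₀ , aj₀≉0) , a⊥rows) =
    a , (j₀ , PF.≉0⇒≉ₜ0 aj₀≉0) ,
    λ i → Null-resp (λ j → *-congˡₜ (a j) (A′≈FA i j)) (Σ≈0⇒Null (lower (a⊥rows i)))

  dependent⇒lift-dependent : ColumnsDependent → ∃ λ A′ → Lifts A′ A × KT.LinDep (KT.column A′)
  dependent⇒lift-dependent (a , (j₀ , aj₀≉0) , a⊥rows) =
    (λ i j → weight i j * A i j) ,
    (λ i j → inj₂ (weight i j , proj₁ (proj₂ (a⊥rows i)) j , refl)) ,
    a , (j₀ , PF.≉ₜ0⇒≉0 aj₀≉0) ,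
    λ i → lift (trans (Σ-cong (λ j → x∙yz≈y∙xz (a j) (weight i j) (A i j))) (proj₂ (proj₂ (a⊥rows i))))
    where
    weight : Fin m → Fin n → Carrier
    weight i = proj₁ (a⊥rows i)

  liftRank⇔independent : LiftRank A n ⇔ (¬ ColumnsDependent)
  liftRank⇔independent = mk⇔ rank≡n⇒independent independent⇒rank≡n
    where
    rank≡n⇒independent : LiftRank A n → ¬ ColumnsDependent
    rank≡n⇒independent (_ , minimal) dependent =
      let A′ , A′≈FA , A′-dependent = dependent⇒lift-dependent dependent
          module RA′ = PK.Ranks A′
      in RA′.¬¬-colRank λ (r , colRank) →
           let r≡n = ℕP.≤-antisym (FinP.injective⇒≤ (proj₁ (proj₂ (proj₁ colRank))))
                                  (minimal r (A′ , A′≈FA , colRank))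
           in Equivalence.to RA′.colRank⇔independent (≡.subst (KT.ColRank A′) r≡n colRank) A′-dependent
    independent⇒rank≡n : ¬ ColumnsDependent → LiftRank A n
    independent⇒rank≡n independent =
      (A , (λ i j → ≈⇒≈F refl) ,
       Equivalence.from (PK.Ranks.colRank⇔independent A)
         (independent ∘′ lift-dependent⇒dependent (λ i j → ≈⇒≈F refl))) ,
      λ s (A′ , A′≈FA , (_ , maximal)) →
        maximal n ((λ j → j) , (λ {_} {_} eq → eq) , independent ∘′ lift-dependent⇒dependent A′≈FA)

  scaled-multiple-orth : ∀ {cv X Y : Fin n → Carrier} b c → (∀ j → X j ≈ b * cv j) →
                         NullF (λ j → cv j * Y j) → NullF (λ j → (c * X j) * Y j)
  scaled-multiple-orth {cv} {X} {Y} b c X≈bcv cv⊥Y = Null-resp (λ j → ≈⇒≈F (begin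
    (c * b) * (cv j * Y j)  ≈⟨ *-assoc _ _ _ ⟨
    ((c * b) * cv j) * Y j  ≈⟨ *-congʳ (*-assoc c b (cv j)) ⟩
    (c * (b * cv j)) * Y j  ≈⟨ *-congʳ (*-congˡ (X≈bcv j)) ⟨
    (c * X j) * Y j         ∎)) (Null-scale (c * b) cv⊥Y)
    where open import Relation.Binary.Reasoning.Setoid setoid

  lowRankPush⇒¬¬dependent : ∀ {s} (M : KT.TMatroid n s) → s < n → (∀ i → PushCovector M (A i)) →
                            ¬¬ ColumnsDependent
  lowRankPush⇒¬¬dependent M s<n rowsCovectors =
    ¬¬-bind (PK.¬¬-nonzeroCircuit M s<n) λ (X , X∈𝒞 , j , Xj≉0) →
    ¬¬-pure ((λ k → 1# * X k) , (j , PF.≉0⇒≉ₜ0 (λ 1Xj≈0 → Xj≉0 (trans (sym (*-identityˡ _)) 1Xj≈0))) ,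
             λ i → rowsCovectors i X X∈𝒞 1# (PF.≉0⇒≉ₜ0 1≉0))

  phiMatRank⇔independent : PhiMatRank A n ⇔ (¬ ColumnsDependent)
  phiMatRank⇔independent = mk⇔ rank≡n⇒independent independent⇒rank≡n
    where
    rank≡n⇒independent : PhiMatRank A n → ¬ ColumnsDependent
    rank≡n⇒independent (_ , minimal) (a , (j₀ , aj₀≉0) , a⊥rows) =
      PK.¬¬-support a λ (C , a-supp) →
        let open PK.SingleCircuit a a-supp (PK.nonzero⇒∈supp a-supp (PF.≉ₜ0⇒≉0 aj₀≉0)) using (tmatroid)
        in ℕP.<⇒≱ (Fin⇒n∸1<n j₀) (minimal (n ∸ 1) (tmatroid ,
             λ i X (b , _ , X≈ba) c _ → scaled-multiple-orth b c X≈ba (a⊥rows i)))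
    independent⇒rank≡n : ¬ ColumnsDependent → PhiMatRank A n
    independent⇒rank≡n independent = (PK.freeTMatroid n , λ i X ()) ,
      λ s (M , rowsCovectors) → ℕP.≮⇒≥ λ s<n → lowRankPush⇒¬¬dependent M s<n rowsCovectors independent

theorem4p15 : ∀ {c ℓ} (K : Field c ℓ) (S : Subgroup× K) {m n : ℕ}
              (A : OverTract.Matrix (Quotient.quotientTract K S) m n) → n ≤ m →
              (Phi.LiftRank K S A n ⇔ Phi.PhiMatRank K S A n)
              × (Phi.PhiMatRank K S A n ⇔ OverTract.ColRank (Quotient.quotientTract K S) A n)
              × (OverTract.ColRank (Quotient.quotientTract K S) A n ⇔ OverTract.MatRank (Quotient.quotientTract K S) A n)
theorem4p15 K S A _ =
    ⇔-sym phiMatRank⇔independent ⇔-∘ liftRank⇔independent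
  , ⇔-sym colRank⇔independent ⇔-∘ phiMatRank⇔independent
  , ⇔-sym matRank⇔independent ⇔-∘ colRank⇔independent
  where open FourRanks K S A
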